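{- For any Dyck path $d$ of semilength $n$, we have $m_d \le 2n - 1 - \mathrm{bpk}(d)$, where $m_d = \deg C_d(t)$ and $\mathrm{bpk}(d)$ is the number of peaks of the bounce path of $d$.
   Context: A Dyck path of semilength $n$ is a lattice path from $(0,0)$ to $(2n,0)$ with steps $U=(1,1)$ and $D=(1,-1)$ never going below the $x$-axis. A peak is an occurrence of $UD$. The bounce path of $d$ is constructed as follows: start at $(0,0)$ and take up-steps until reaching (the starting point of) a down-step of $d$, i.e. until the current point lies on $d$ and the next step of $d$ is a down-step; then take down-steps until reaching the $x$-axis; then again take up-steps until encountering a down-step of $d$, and repeat until $(2n,0)$ is reached. $\mathrm{bpk}(d)$ is the number of peaks of the bounce path. For $\sigma=\sigma_1\cdots\sigma_n\in\mathfrak{S}_n$, $\mathrm{can}(d,\sigma)$ is the word of length $2n$ obtained by labeling the $i$-th up-step and the $i$-th down-step of $d$ with $\sigma_i$ and reading the labels left to right. $\mathrm{des}(d,\sigma)$ is the number of indices $j\in[2n-1]$ with $\mathrm{can}(d,\sigma)_j>\mathrm{can}(d,\sigma)_{j+1}$. $C_d(t)=\sum_{\sigma\in\mathfrak{S}_n} t^{\mathrm{des}(d,\sigma)}$ and $m_d=\deg C_d(t)$, i.e. the maximum of $\mathrm{des}(d,\sigma)$ over $\sigma\in\mathfrak{S}_n$. -}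

module Defs where

open import Data.Nat using (ℕ; zero; suc; _+_; _*_; _∸_; _<ᵇ_; _≟_)
open import Data.Bool using (if_then_else_)
open import Data.List using (List; []; _∷_; length; map; drop; take)
open import Data.Fin using (Fin; toℕ)
open import Data.Fin.Permutation using (Permutation′; _⟨$⟩ʳ_)
open import Data.Maybe using (Maybe; just; nothing)
open import Data.Product using (_×_; _,_)
open import Relation.Nullary using (yes; no)
open import Relation.Binary.PropositionalEquality using (_≡_)

-- Steps of a lattice path: U = (1,1), D = (1,-1)
data Step : Set where
  U D : Step

data Ballot : ℕ → List Step → Set where
  done : Ballot zero []
  up   : ∀ {h s} → Ballot (suc h) s → Ballot h (U ∷ s)
  down : ∀ {h s} → Ballot h s → Ballot (suc h) (D ∷ s)

record Dyck (n : ℕ) (d : List Step) : Set where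
  field
    len    : length d ≡ 2 * n
    ballot : Ballot zero d

heightAfter : ℕ → List Step → ℕ
heightAfter h []      = h
heightAfter h (U ∷ s) = heightAfter (suc h) s
heightAfter h (D ∷ s) = heightAfter (h ∸ 1) s

-- Bounce: the bounce path is at height 0 at the current position, where d has
-- height h and remaining steps s.  After j up-steps of the bounce path, d has
-- height h' and remaining steps s'.  Stop at the first j where the bounce
-- point lies on d (h' = j) and the next step of d is a down-step; return j
-- together with the remaining steps of d from that point.
findApex : ℕ → ℕ → List Step → Maybe (ℕ × List Step)
findApex h j []      = nothing
findApex h j (U ∷ s) = findApex (suc h) (suc j) s
findApex h j (D ∷ s) with h ≟ j
... | yes _ = just (j , D ∷ s)
... | no  _ = findApex (h ∸ 1) (suc j) s

-- number of peaks of the bounce path: each up-run of length k followed by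
-- k down-steps back to the x-axis contributes one peak.  Fuel bounds the
-- number of bounces (at most the length of the path).
bounceFrom : ℕ → ℕ → List Step → ℕ
bounceFrom zero    h s  = 0
bounceFrom (suc f) h [] = 0
bounceFrom (suc f) h (x ∷ s) with findApex h 0 (x ∷ s)
... | nothing      = 0
... | just (k , r) = suc (bounceFrom f (heightAfter (heightAfter h (take k (x ∷ s))) (take k r)) (drop k r))

bpk : List Step → ℕ
bpk d = bounceFrom (length d) 0 d

-- labeling word: the i-th up-step and i-th down-step get the i-th label
canWord : List ℕ → List ℕ → List Step → List ℕ
canWord (a ∷ as) bs       (U ∷ s) = a ∷ canWord as bs s
canWord as       (b ∷ bs) (D ∷ s) = b ∷ canWord as bs s
canWord _        _        _       = []

-- σ as the word σ₁ ⋯ σₙ (values 0..n-1; shifting by 1 does not affect descents)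
permWord : ∀ {n} → Permutation′ n → List ℕ
permWord {n} σ = map (λ i → toℕ (σ ⟨$⟩ʳ i)) (Data.List.allFin n)

can : ∀ {n} → List Step → Permutation′ n → List ℕ
can d σ = canWord (permWord σ) (permWord σ) d

des : List ℕ → ℕ
des []           = 0
des (a ∷ [])     = 0
des (a ∷ b ∷ w)  = (if b <ᵇ a then 1 else 0) + des (b ∷ w)

desPath : ∀ {n} → List Step → Permutation′ n → ℕ
desPath d σ = des (can d σ)

-- If the bounce path has up-runs k₁, k₂, …, put Kᵢ = k₁ + ⋯ + kᵢ.  At the i-th bounce peak d has
-- used exactly Kᵢ up-steps and Kᵢ₋₁ down-steps and continues with its (Kᵢ₋₁+1)-th down-step, so
-- the letter σ_{Kᵢ₋₁+1} read there was read before at the (Kᵢ₋₁+1)-th up-step, which comes after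
-- the previous peak.  Between two equal letters of a word some adjacent pair is not a descent,
-- and these windows are disjoint, so at least bpk(d) of the 2n − 1 adjacent pairs of can(d,σ)
-- are not descents.
module Submission where

open import Defs
open import Data.Nat using (ℕ; _*_; _∸_; _≤_)
open import Data.List using (List)
open import Data.Fin.Permutation using (Permutation′)

open import Data.Nat using (zero; suc; _+_; _<ᵇ_; z≤n; s≤s; ⌊_/2⌋)
open import Data.Nat.Properties
open import Data.Bool using (true; false; if_then_else_; T)
open import Data.Unit using (tt)
open import Data.Empty using (⊥-elim)
open import Data.List using ([]; _∷_; _++_; length; take; drop; allFin)
open import Data.List.Properties using (length-++; length-map; length-tabulate; ++-assoc; drop-[]; drop-all; take++drop≡id; length-take)
open import Data.Maybe using (just; nothing)
open import Data.Product using (_,_)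
open import Relation.Nullary using (yes; no)
open import Relation.Binary.PropositionalEquality
open import Data.Nat.Solver using (module +-*-Solver)
open +-*-Solver

double-injective : ∀ m n → m + m ≡ n + n → m ≡ n
double-injective m n eq = trans (n≡⌊n+n/2⌋ m) (trans (cong ⌊_/2⌋ eq) (sym (n≡⌊n+n/2⌋ n)))

take-prefix : ∀ {A : Set} (xs : List A) {ys n} → length xs ≡ n → take n (xs ++ ys) ≡ xs
take-prefix []       refl = refl
take-prefix (x ∷ xs) refl = cong (x ∷_) (take-prefix xs refl)

descent : ℕ → ℕ → ℕ
descent x y = if y <ᵇ x then 1 else 0

n<ᵇn≡false : ∀ n → (n <ᵇ n) ≡ false
n<ᵇn≡false zero = refl
n<ᵇn≡false (suc n) = n<ᵇn≡false n

n<ᵇ1+n≡true : ∀ n → (n <ᵇ suc n) ≡ true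
n<ᵇ1+n≡true zero = refl
n<ᵇ1+n≡true (suc n) = n<ᵇ1+n≡true n

descent≤1 : ∀ x y → descent x y ≤ 1
descent≤1 x y with y <ᵇ x
... | true = ≤-refl
... | false = z≤n

descent-trans : ∀ x y z → descent x y + descent y z ≤ 1 + descent x z
descent-trans x y z with y <ᵇ x in y<x | z <ᵇ y in z<y | z <ᵇ x in z<x
... | false | false | _     = z≤n
... | false | true  | _     = s≤s z≤n
... | true  | false | _     = s≤s z≤n
... | true  | true  | true  = ≤-refl
... | true  | true  | false =
  ⊥-elim (subst T z<x (<⇒<ᵇ (<-trans (<ᵇ⇒< z y (subst T (sym z<y) tt)) (<ᵇ⇒< y x (subst T (sym y<x) tt)))))

-- The head t of the list is the watched letter: it has been read once, and reading it again
-- closes the current window.  If t < x a non-descent has already occurred since t was read;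
-- otherwise the step from the last letter x to t will not be a descent.
slack : ℕ → List ℕ → ℕ
slack x []      = 0
slack x (t ∷ _) = descent x t

slack-step : ∀ x y T → descent x y + slack y T ≤ 1 + slack x T
slack-step x y []      = +-monoˡ-≤ 0 (descent≤1 x y)
slack-step x y (t ∷ _) = descent-trans x y t

slack-drop-∷ʳ : ∀ c p a → slack a (drop c (p ++ a ∷ [])) ≡ slack a (drop c p)
slack-drop-∷ʳ zero    []      a = cong (λ b → if b then 1 else 0) (n<ᵇn≡false a)
slack-drop-∷ʳ zero    (t ∷ p) a = refl
slack-drop-∷ʳ (suc c) []      a = cong (slack a) (drop-[] c)
slack-drop-∷ʳ (suc c) (t ∷ p) a = slack-drop-∷ʳ c p a

des-∷-≤-length : ∀ x w → des (x ∷ w) ≤ length w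
des-∷-≤-length x []      = z≤n
des-∷-≤-length x (y ∷ w) = +-mono-≤ (descent≤1 x y) (des-∷-≤-length y w)

-- d₀ − s₀ ≤ m + (d₁ − s₁) over the integers, with everything moved so that no subtraction occurs.
record Cost (d₀ s₀ m d₁ s₁ : ℕ) : Set where
  constructor cost
  field bound : d₀ + s₁ ≤ m + (d₁ + s₀)

cost-trans : ∀ {a b m c d n e f} → Cost a b m c d → Cost c d n e f → Cost a b (m + n) e f
cost-trans {a} {b} {m} {c} {d} {n} {e} {f} (cost ab) (cost cd) = cost (+-cancelʳ-≤ (c + d) (a + f) (m + n + (e + b)) (begin
  a + f + (c + d)
    ≡⟨ solve 4 (λ a c d f → a :+ f :+ (c :+ d) := (a :+ d) :+ (c :+ f)) refl a c d f ⟩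
  (a + d) + (c + f)
    ≤⟨ +-mono-≤ ab cd ⟩
  (m + (c + b)) + (n + (e + d))
    ≡⟨ solve 6 (λ b c d e m n → (m :+ (c :+ b)) :+ (n :+ (e :+ d)) := m :+ n :+ (e :+ b) :+ (c :+ d))
               refl b c d e m n ⟩
  m + n + (e + b) + (c + d) ∎))
  where open ≤-Reasoning

des-step : ∀ x y w T → Cost (des (x ∷ y ∷ w)) (slack x T) 1 (des (y ∷ w)) (slack y T)
des-step x y w T = cost (begin
  descent x y + des (y ∷ w) + slack y T
    ≡⟨ solve 3 (λ a b c → a :+ b :+ c := b :+ (a :+ c)) refl (descent x y) (des (y ∷ w)) (slack y T) ⟩
  des (y ∷ w) + (descent x y + slack y T)
    ≤⟨ +-monoʳ-≤ (des (y ∷ w)) (slack-step x y T) ⟩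
  des (y ∷ w) + (1 + slack x T)
    ≡⟨ solve 2 (λ a b → a :+ (con 1 :+ b) := con 1 :+ (a :+ b)) refl (des (y ∷ w)) (slack x T) ⟩
  1 + (des (y ∷ w) + slack x T) ∎)
  where open ≤-Reasoning

des-bound : ∀ w {B N} → (∀ x → des (x ∷ w) + B ≤ N) → des w ≤ N ∸ 1 ∸ B
des-bound []      _     = z≤n
des-bound (a ∷ w) {B} {N} bound = begin
  des (a ∷ w)       ≤⟨ m+n≤o⇒m≤o∸n (des (a ∷ w)) (subst (_≤ N) (sym (+-suc (des (a ∷ w)) B)) leading) ⟩
  N ∸ suc B         ≡⟨ ∸-+-assoc N 1 B ⟨
  N ∸ 1 ∸ B         ∎
  where
    open ≤-Reasoning
    leading : suc (des (a ∷ w)) + B ≤ N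
    leading = subst (λ b → (if b then 1 else 0) + des (a ∷ w) + B ≤ N) (n<ᵇ1+n≡true a) (bound (suc a))

ups downs : List Step → ℕ
ups []      = 0
ups (U ∷ s) = suc (ups s)
ups (D ∷ s) = ups s
downs []      = 0
downs (U ∷ s) = downs s
downs (D ∷ s) = suc (downs s)

length≡ups+downs : ∀ s → length s ≡ ups s + downs s
length≡ups+downs []      = refl
length≡ups+downs (U ∷ s) = cong suc (length≡ups+downs s)
length≡ups+downs (D ∷ s) = trans (cong suc (length≡ups+downs s)) (sym (+-suc (ups s) (downs s)))

downs≤length : ∀ s → downs s ≤ length s
downs≤length s = ≤-trans (m≤n+m (downs s) (ups s)) (≤-reflexive (sym (length≡ups+downs s)))

ballot-balance : ∀ {h s} → Ballot h s → h + ups s ≡ downs s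
ballot-balance done                 = refl
ballot-balance {h} {U ∷ s} (up b)   = trans (+-suc h (ups s)) (ballot-balance b)
ballot-balance        (down b)      = cong suc (ballot-balance b)

ballot-++⁻ʳ : ∀ {h} pre {rest} → Ballot h (pre ++ rest) → Ballot (heightAfter h pre) rest
ballot-++⁻ʳ []        b        = b
ballot-++⁻ʳ (U ∷ pre) (up b)   = ballot-++⁻ʳ pre b
ballot-++⁻ʳ (D ∷ pre) (down b) = ballot-++⁻ʳ pre b

heightAfter-balance : ∀ {h} pre {rest} → Ballot h (pre ++ rest) → heightAfter h pre + downs pre ≡ h + ups pre
heightAfter-balance []            b        = refl
heightAfter-balance {h} (U ∷ pre) (up b)   = trans (heightAfter-balance pre b) (sym (+-suc h (ups pre)))
heightAfter-balance     (D ∷ pre) (down b) = trans (+-suc _ (downs pre)) (cong suc (heightAfter-balance pre b))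

data ApexAt (h j : ℕ) : List Step → ℕ → List Step → Set where
  apex : ∀ pre k r → j + length pre ≡ suc k → heightAfter h pre ≡ suc k →
         ApexAt h j (pre ++ D ∷ r) (suc k) (D ∷ r)

findApex-apex : ∀ {h j s k r} → Ballot h s → findApex h j s ≡ just (k , r) → ApexAt h j s k r
findApex-apex {h} {j} {U ∷ s} (up b) found with findApex-apex b found
... | apex pre k r len hgt = apex (U ∷ pre) k r (trans (+-suc j (length pre)) len) hgt
findApex-apex {suc h} {j} {D ∷ s} (down b) found with suc h ≟ j
findApex-apex {suc h} {.(suc h)} {D ∷ s} (down b) refl | yes refl = apex [] h s (+-identityʳ (suc h)) refl
... | no _ with findApex-apex b found
...   | apex pre k r len hgt = apex (D ∷ pre) k r (trans (+-suc j (length pre)) len) hgt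

canWord-D : ∀ as b bs s → canWord as (b ∷ bs) (D ∷ s) ≡ b ∷ canWord as bs s
canWord-D []       b bs s = refl
canWord-D (a ∷ as) b bs s = refl

length-canWord : ∀ as bs s → length (canWord as bs s) ≤ length s
length-canWord (a ∷ as) bs       (U ∷ s) = s≤s (length-canWord as bs s)
length-canWord []       []       (U ∷ s) = z≤n
length-canWord []       (b ∷ bs) (U ∷ s) = z≤n
length-canWord as       (b ∷ bs) (D ∷ s) rewrite canWord-D as b bs s = s≤s (length-canWord as bs s)
length-canWord []       []       (D ∷ s) = z≤n
length-canWord (a ∷ as) []       (D ∷ s) = z≤n
length-canWord []       []       []      = z≤n
length-canWord []       (b ∷ bs) []      = z≤n
length-canWord (a ∷ as) []       []      = z≤n
length-canWord (a ∷ as) (b ∷ bs) []      = z≤n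

-- p is the queue of labels of up-steps still waiting for their down-step, so the rest of
-- can(d,σ) is canWord as (p ++ as) s.  The watched letter is at index c of p ++ as, so drop c p
-- is non-empty exactly when it has already been read.
record Walk (pre rest : List Step) (h c : ℕ) (as p : List ℕ) (x : ℕ) : Set where
  constructor walked
  field
    as′ p′ : List ℕ
    x′ : ℕ
    length-as′ : length as′ ≡ ups rest
    length-p′ : length p′ ≡ heightAfter h pre
    walk-cost : Cost (des (x ∷ canWord as (p ++ as) (pre ++ rest))) (slack x (drop c p))
                     (length pre)
                     (des (x′ ∷ canWord as′ (p′ ++ as′) rest)) (slack x′ (drop (c ∸ downs pre) p′))

walk : ∀ pre {rest h c as p} x → Ballot h (pre ++ rest) → length as ≡ ups (pre ++ rest) → length p ≡ h →
       downs pre ≤ c → Walk pre rest h c as p x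
walk [] {as = as} {p} x b las lp _ = walked as p x las lp (cost ≤-refl)
walk (U ∷ pre) {rest} {h} {c} {a ∷ as} {p} x (up b) las lp dc
  with walk pre {as = as} {p ++ a ∷ []} a b (suc-injective las)
             (trans (length-++ p) (trans (+-comm (length p) 1) (cong suc lp))) dc
... | walked as′ p′ x′ las′ lp′ rest-cost = walked as′ p′ x′ las′ lp′
  (cost-trans (des-step x a (canWord as (p ++ a ∷ as) (pre ++ rest)) (drop c p))
    (subst₂ (λ w s → Cost (des (a ∷ canWord as w (pre ++ rest))) s _ _ _)
            (++-assoc p (a ∷ []) as) (slack-drop-∷ʳ c p a) rest-cost))
walk (D ∷ pre) {rest} {suc h} {suc c} {as} {b ∷ p} x (down bl) las lp (s≤s dc)
  with walk pre {as = as} {p} b bl las (suc-injective lp) dc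
... | walked as′ p′ x′ las′ lp′ rest-cost = walked as′ p′ x′ las′ lp′
  (subst (λ w → Cost (des (x ∷ w)) _ _ _ _) (sym (canWord-D as b (p ++ as) (pre ++ rest)))
    (cost-trans (des-step x b (canWord as (p ++ as) (pre ++ rest)) (drop c p)) rest-cost))

apex-downs : ∀ {h c k} pre {rest} → Ballot h (pre ++ rest) → h ≡ c + c →
             length pre ≡ k → heightAfter h pre ≡ k → downs pre ≡ c
apex-downs {h} {c} {k} pre b hc len hgt = double-injective (downs pre) c (+-cancelˡ-≡ (ups pre) _ _ (begin
  ups pre + (downs pre + downs pre)   ≡⟨ solve 2 (λ u v → u :+ (v :+ v) := (u :+ v) :+ v) refl (ups pre) (downs pre) ⟩
  (ups pre + downs pre) + downs pre   ≡⟨ cong (_+ downs pre) (trans (sym (length≡ups+downs pre)) (trans len (sym hgt))) ⟩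
  heightAfter h pre + downs pre       ≡⟨ heightAfter-balance pre b ⟩
  h + ups pre                         ≡⟨ trans (cong (_+ ups pre) hc) (+-comm (c + c) (ups pre)) ⟩
  ups pre + (c + c)                   ∎))
  where open ≡-Reasoning

descent-height : ∀ {k} mid {rest} → Ballot k (mid ++ rest) → length mid ≡ k →
                 heightAfter k mid ≡ (k ∸ downs mid) + (k ∸ downs mid)
descent-height {k} mid b len = trans height (cong (λ u → u + u) (sym k∸downs))
  where
    k≡ : k ≡ ups mid + downs mid
    k≡ = trans (sym len) (length≡ups+downs mid)
    k∸downs : k ∸ downs mid ≡ ups mid
    k∸downs = trans (cong (_∸ downs mid) k≡) (m+n∸n≡m (ups mid) (downs mid))
    height : heightAfter k mid ≡ ups mid + ups mid
    height = +-cancelʳ-≡ (downs mid) _ _ (begin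
      heightAfter k mid + downs mid       ≡⟨ heightAfter-balance mid b ⟩
      k + ups mid                         ≡⟨ cong (_+ ups mid) k≡ ⟩
      ups mid + downs mid + ups mid       ≡⟨ solve 2 (λ u v → u :+ v :+ u := u :+ u :+ v) refl (ups mid) (downs mid) ⟩
      ups mid + ups mid + downs mid       ∎)
      where open ≡-Reasoning

-- At a return of the bounce path to the axis d has even height h = 2c, and the letter read at
-- the next bounce peak is at index c of p ++ as.
BounceCost : ℕ → Set
BounceCost f = ∀ h c s as p x → Ballot h s → length as ≡ ups s → length p ≡ h → h ≡ c + c →
               des (x ∷ canWord as (p ++ as) s) + bounceFrom f h s ≤ length s + slack x (drop c p)

descend : ∀ {f k} mid {rest as p} x → BounceCost f → Ballot k (mid ++ rest) → length mid ≡ k →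
          length as ≡ ups (mid ++ rest) → length p ≡ k →
          des (x ∷ canWord as (p ++ as) (mid ++ rest)) + bounceFrom f (heightAfter k mid) rest ≤ length (mid ++ rest)
descend {f} {k} mid {rest} {as} {p} x IH b len las lp
  with walk mid {c = k} {as} {p} x b las lp (subst (downs mid ≤_) len (downs≤length mid))
... | walked as′ p′ x′ las′ lp′ fall = begin
  des (x ∷ canWord as (p ++ as) (mid ++ rest)) + bounceFrom f (heightAfter k mid) rest
    ≤⟨ Cost.bound (cost-trans fall (cost (IH (heightAfter k mid) (k ∸ downs mid) rest as′ p′ x′
                                             (ballot-++⁻ʳ mid b) las′ lp′ (descent-height mid b len)))) ⟩
  length mid + length rest + slack x (drop k p)
    ≡⟨ cong₂ _+_ (sym (length-++ mid)) (cong (slack x) (drop-all k p (≤-reflexive lp))) ⟩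
  length (mid ++ rest) + 0
    ≡⟨ +-identityʳ _ ⟩
  length (mid ++ rest) ∎
  where open ≤-Reasoning

after-apex : ∀ {f k r as p} x → BounceCost f → Ballot k r → length as ≡ ups r → length p ≡ k →
             des (x ∷ canWord as (p ++ as) r) + bounceFrom f (heightAfter k (take k r)) (drop k r) ≤ length r
after-apex {f} {k} {r} {as} {p} x IH b las lp =
  subst (λ r′ → des (x ∷ canWord as (p ++ as) r′) + bounceFrom f (heightAfter k (take k r)) (drop k r) ≤ length r′)
        (take++drop≡id k r)
        (descend {f} {k} (take k r) {drop k r} {as} {p} x IH
                 (subst (Ballot k) split b) len (subst (λ r′ → length as ≡ ups r′) split las) lp)
  where
    split : r ≡ take k r ++ drop k r
    split = sym (take++drop≡id k r)
    k≤length : k ≤ length r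
    k≤length = begin
      k                   ≤⟨ m≤m+n k (ups r) ⟩
      k + ups r           ≡⟨ ballot-balance b ⟩
      downs r             ≤⟨ downs≤length r ⟩
      length r            ∎
      where open ≤-Reasoning
    len : length (take k r) ≡ k
    len = trans (length-take k r) (m≤n⇒m⊓n≡m k≤length)

apex-cost : ∀ {f k r as p} x → BounceCost f → Ballot (suc k) (D ∷ r) → length as ≡ ups r → length p ≡ suc k →
            Cost (des (x ∷ canWord as (p ++ as) (D ∷ r))) (slack x p) (suc (length r))
                 0 (suc (bounceFrom f (heightAfter k (take k r)) (drop k r)))
apex-cost {f} {k} {r} {as} {t ∷ p} x IH (down b) las lp
  rewrite canWord-D as t (p ++ as) r = cost (begin
    descent x t + des (t ∷ W) + suc B
      ≡⟨ solve 3 (λ s d b → s :+ d :+ (con 1 :+ b) := con 1 :+ (d :+ b) :+ s) refl (descent x t) (des (t ∷ W)) B ⟩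
    suc (des (t ∷ W) + B) + descent x t
      ≤⟨ +-monoˡ-≤ (descent x t) (s≤s (after-apex {f} {k} {r} {as} {p} t IH b las (suc-injective lp))) ⟩
    suc (length r) + descent x t ∎)
  where
    open ≤-Reasoning
    W = canWord as (p ++ as) r
    B = bounceFrom f (heightAfter k (take k r)) (drop k r)

apex-bounce : ∀ {f h c s as p k r} x → BounceCost f → Ballot h s → length as ≡ ups s → length p ≡ h →
              h ≡ c + c → findApex h 0 s ≡ just (k , r) →
              des (x ∷ canWord as (p ++ as) s)
                + suc (bounceFrom f (heightAfter (heightAfter h (take k s)) (take k r)) (drop k r))
                ≤ length s + slack x (drop c p)
apex-bounce {f} {h} {c} {as = as} {p} x IH b las lp hc found with findApex-apex b found
... | apex pre k r len hgt with apex-downs {c = c} pre b hc len hgt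
...   | refl rewrite take-prefix pre {D ∷ r} len | hgt
  with walk pre {c = downs pre} {as} {p} x b las lp ≤-refl
...     | walked as′ p′ x′ las′ lp′ rise =
  subst (λ l → des (x ∷ W) + suc B ≤ l + slack x (drop (downs pre) p)) (sym (length-++ pre))
        (Cost.bound (cost-trans rise′ (apex-cost {f} {k} {r} {as′} {p′} x′ IH ballot′ las′ (trans lp′ hgt))))
  where
    W = canWord as (p ++ as) (pre ++ D ∷ r)
    B = bounceFrom f (heightAfter k (take k r)) (drop k r)
    W′ = canWord as′ (p′ ++ as′) (D ∷ r)
    rise′ : Cost (des (x ∷ W)) (slack x (drop (downs pre) p)) (length pre) (des (x′ ∷ W′)) (slack x′ p′)
    rise′ = subst (λ i → Cost (des (x ∷ W)) (slack x (drop (downs pre) p)) (length pre)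
                              (des (x′ ∷ W′)) (slack x′ (drop i p′)))
                  (n∸n≡0 (downs pre)) rise
    ballot′ : Ballot (suc k) (D ∷ r)
    ballot′ = subst (λ h′ → Ballot h′ (D ∷ r)) hgt (ballot-++⁻ʳ pre b)

no-bounce-cost : ∀ x as bs s m → des (x ∷ canWord as bs s) + 0 ≤ length s + m
no-bounce-cost x as bs s m = begin
  des (x ∷ canWord as bs s) + 0 ≡⟨ +-identityʳ _ ⟩
  des (x ∷ canWord as bs s)     ≤⟨ des-∷-≤-length x (canWord as bs s) ⟩
  length (canWord as bs s)      ≤⟨ length-canWord as bs s ⟩
  length s                      ≤⟨ m≤m+n (length s) m ⟩
  length s + m                  ∎
  where open ≤-Reasoning

bounce-cost : ∀ f → BounceCost f
bounce-cost zero    h c s        as p x _ _ _ _ = no-bounce-cost x as (p ++ as) s _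
bounce-cost (suc f) h c []       as p x _ _ _ _ = no-bounce-cost x as (p ++ as) [] _
bounce-cost (suc f) h c (st ∷ s) as p x b las lp hc with findApex h 0 (st ∷ s) in found
... | nothing      = no-bounce-cost x as (p ++ as) (st ∷ s) _
... | just (k , r) = apex-bounce {f} {h} {c} {st ∷ s} {as} {p} x (bounce-cost f) b las lp hc found

dyck-ups : ∀ {n d} → Dyck n d → ups d ≡ n
dyck-ups {n} {d} dy = double-injective (ups d) n (begin
  ups d + ups d   ≡⟨ cong (ups d +_) (ballot-balance (Dyck.ballot dy)) ⟩
  ups d + downs d ≡⟨ length≡ups+downs d ⟨
  length d        ≡⟨ Dyck.len dy ⟩
  n + (n + 0)     ≡⟨ cong (n +_) (+-identityʳ n) ⟩
  n + n           ∎)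
  where open ≡-Reasoning

lemma3p5 : (n : ℕ) (d : List Step) → Dyck n d →
    (σ : Permutation′ n) → desPath d σ ≤ 2 * n ∸ 1 ∸ bpk d
lemma3p5 n d dy σ = des-bound (can d σ) λ x →
  subst (des (x ∷ can d σ) + bpk d ≤_) (trans (+-identityʳ (length d)) (Dyck.len dy))
        (bounce-cost (length d) 0 0 d (permWord σ) [] x (Dyck.ballot dy) labels refl refl)
  where
    labels : length (permWord σ) ≡ ups d
    labels = trans (length-map _ (allFin n)) (trans (length-tabulate (λ i → i)) (sym (dyck-ups dy)))
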